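{- Let $1\le k<n$ and $w=(y_1,\dots,y_{k-r},\overline{z_r},\dots,\overline{z_1},v_1,\dots,v_{n-k-1},\widehat{v_{n-k}})\in W^{OG(k,2n)}$. Define $\alpha^{\bf t}_s=k-v_s+s+|\{j:z_j<v_s\}|$ for $1\le s\le n-k$. Then for $1\le i\le k$, the length $|\{s:\alpha^{\bf t}_s\ge i\}|$ of the $i$-th column of $\alpha^{\bf t}$ equals $n-k$ if $i\le r$ (i.e. $k+1-i\in\{k-r+1,\dots,k\}$), and equals $|\{l:y_{k+1-i}>v_l\}|$ if $i>r$.
   Context: $W^{OG(k,2n)}$ is the set of signed permutations with an even number of barred (negative) entries, written $(y_1,\dots,y_{k-r},\overline{z_r},\dots,\overline{z_1},v_1,\dots,v_{n-k-1},\widehat{v_{n-k}})$ with $0\le r\le k$, $\{y\}\cup\{z\}\cup\{v\}=\{1,\dots,n\}$, $y_1<\dots<y_{k-r}$, $z_r>\dots>z_1$, $v_1<\dots<v_{n-k}$, and $\widehat{v_{n-k}}$ equal to $v_{n-k}$ or $\overline{v_{n-k}}$ according to the parity of $r$. -}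

module Defs where

open import Data.Nat as ℕ using (ℕ; suc; _∸_; _<_; _≤_)
open import Data.Integer as ℤ using (ℤ; +_; _-_; _+_)
open import Data.Fin using (Fin; toℕ)
open import Data.List using (length; filter; allFin)
open import Data.Product using (∃; _×_)
open import Data.Sum using (_⊎_)
open import Relation.Binary.PropositionalEquality using (_≡_; _≢_)
open import Relation.Unary using (Pred; Decidable)
open import Level using (0ℓ)

count : (m : ℕ) (P : Pred (Fin m) 0ℓ) → Decidable P → ℕ
count m P P? = length (filter P? (allFin m))

-- Entries are 1-based values; families are 0-indexed by Fin:
--   y (a) = y_{a+1}, z (a) = z_{a+1}, v (a) = v_{a+1}.
StrictlyIncreasing : {m : ℕ} → (Fin m → ℕ) → Set
StrictlyIncreasing {m} f = ∀ (a b : Fin m) → toℕ a < toℕ b → f a < f b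

InRange : (n : ℕ) {m : ℕ} → (Fin m → ℕ) → Set
InRange n {m} f = ∀ (a : Fin m) → 1 ≤ f a × f a ≤ n

Disjoint : {m m' : ℕ} → (Fin m → ℕ) → (Fin m' → ℕ) → Set
Disjoint f g = ∀ a b → f a ≢ g b

-- The data (y, z, v) describing an element
-- w = (y_1..y_{k-r}, z̄_r..z̄_1, v_1..v_{n-k-1}, v̂_{n-k}) of W^{OG(k,2n)}
-- (the sign of the last entry is determined by the parity of r).
record OGData (n k r : ℕ) : Set where
  field
    y : Fin (k ∸ r) → ℕ
    z : Fin r → ℕ
    v : Fin (n ∸ k) → ℕ
    y-inc : StrictlyIncreasing y
    z-inc : StrictlyIncreasing z
    v-inc : StrictlyIncreasing v
    y-range : InRange n y
    z-range : InRange n z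
    v-range : InRange n v
    yz-disj : Disjoint y z
    yv-disj : Disjoint y v
    zv-disj : Disjoint z v
    cover : ∀ (m : ℕ) → 1 ≤ m → m ≤ n →
      (∃ λ a → y a ≡ m) ⊎ (∃ λ a → z a ≡ m) ⊎ (∃ λ a → v a ≡ m)

alpha : {n k r : ℕ} → OGData n k r → Fin (n ∸ k) → ℤ
alpha {n} {k} {r} w s =
  ((+ k) - (+ v s)) + (+ suc (toℕ s))
    + (+ count r (λ j → z j < v s) (λ j → z j ℕ.<? v s))
  where open OGData w

colLen : {n k r : ℕ} → OGData n k r → ℕ → ℕ
colLen {n} {k} w i = count (n ∸ k) (λ s → + i ℤ.≤ alpha w s) (λ s → + i ℤ.≤? alpha w s)

-- Sorting the values 1, …, v_s − 1 into y's, z's and v's gives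
-- v_s = 1 + #{y < v_s} + #{z < v_s} + (s − 1), so the definition of α collapses to
-- α_s = k − #{y < v_s}.  Hence α_s ≥ i iff i + #{y < v_s} ≤ k.  For i ≤ r this always
-- holds, as there are only k − r entries y; for i > r, with y_j (0-indexed) and
-- j + i = k, it says #{y < v_s} ≤ j, i.e. v_s < y_j, because the y's increase and
-- avoid v_s.

module Submission where

open import Defs
open import Data.Nat as ℕ using (ℕ; zero; suc; _≤_; _<_; _+_; _∸_; _<?_; _≤?_; z≤n; s≤s; s≤s⁻¹)
open import Data.Nat.Properties
open import Data.Integer as ℤ using (+_)
import Data.Integer.Properties as ℤ
import Data.Integer.Tactic.RingSolver as ℤ-Solver
import Data.Nat.Tactic.RingSolver as ℕ-Solver
open import Data.Fin using (Fin; toℕ; zero; suc)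
open import Data.Fin.Properties using (toℕ-injective; toℕ<n)
open import Data.List using (List; []; _∷_; length; filter; allFin; tabulate)
open import Data.List.Properties using (length-filter; length-tabulate; filter-all; filter-none; filter-accept; filter-≐)
open import Data.List.Relation.Unary.All.Properties using (tabulate⁺)
open import Data.List.Relation.Binary.Sublist.Propositional using (⊆-refl)
open import Data.List.Relation.Binary.Sublist.Propositional.Properties using (filter⁺; length-mono-≤)
open import Data.Product using (_×_; _,_; proj₁; proj₂)
open import Data.Sum using (inj₁; inj₂)
open import Data.Empty using (⊥-elim)
open import Function using (_∘_; id)
open import Level using (0ℓ)
open import Relation.Nullary using (¬_; yes; no)
open import Relation.Unary using (Pred; Decidable; _⊆_; _≐_; _∪_)
open import Relation.Unary.Properties using (_∪?_)
open import Relation.Binary.PropositionalEquality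

length-filter-∪ : {A : Set} {P Q : Pred A 0ℓ} (P? : Decidable P) (Q? : Decidable Q) →
  (∀ {x} → P x → ¬ Q x) → (xs : List A) →
  length (filter (P? ∪? Q?) xs) ≡ length (filter P? xs) + length (filter Q? xs)
length-filter-∪ P? Q? disjoint [] = refl
length-filter-∪ P? Q? disjoint (x ∷ xs) with ih ← length-filter-∪ P? Q? disjoint xs | P? x | Q? x
... | yes p | yes q = ⊥-elim (disjoint p q)
... | yes _ | no _  = cong suc ih
... | no _  | yes _ = trans (cong suc ih) (sym (+-suc _ _))
... | no _  | no _  = ih

length-filter-tabulate : {A : Set} {m : ℕ} {P : Pred A 0ℓ} (P? : Decidable P) (f : Fin m → A) →
  length (filter P? (tabulate f)) ≡ count m (P ∘ f) (P? ∘ f)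
length-filter-tabulate {m = zero} P? f = refl
length-filter-tabulate {m = suc m} P? f
  with shift ← trans (length-filter-tabulate P? (f ∘ suc)) (sym (length-filter-tabulate (P? ∘ f) suc))
     | P? (f zero)
... | yes _ = cong suc shift
... | no _  = shift

module _ {m : ℕ} {P : Pred (Fin m) 0ℓ} (P? : Decidable P) where

  count-≤ : count m P P? ≤ m
  count-≤ = ≤-trans (length-filter P? (allFin m)) (≤-reflexive (length-tabulate id))

  count-all : (∀ a → P a) → count m P P? ≡ m
  count-all all = trans (cong length (filter-all P? (tabulate⁺ all))) (length-tabulate id)

  count-none : (∀ a → ¬ P a) → count m P P? ≡ 0
  count-none none = cong length (filter-none P? (tabulate⁺ none))

count-suc-accept : {m : ℕ} {P : Pred (Fin (suc m)) 0ℓ} (P? : Decidable P) → P zero →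
  count (suc m) P P? ≡ suc (count m (P ∘ suc) (P? ∘ suc))
count-suc-accept P? p = trans (cong length (filter-accept P? p)) (cong suc (length-filter-tabulate P? suc))

module _ {m : ℕ} {P Q : Pred (Fin m) 0ℓ} (P? : Decidable P) (Q? : Decidable Q) where

  count-mono : P ⊆ Q → count m P P? ≤ count m Q Q?
  count-mono P⊆Q = length-mono-≤ (filter⁺ P? Q? (λ { refl → P⊆Q }) (⊆-refl {x = allFin m}))

  count-cong : P ≐ Q → count m P P? ≡ count m Q Q?
  count-cong P≐Q = cong length (filter-≐ P? Q? P≐Q (allFin m))

count-∪ : {m : ℕ} {P Q R : Pred (Fin m) 0ℓ} (P? : Decidable P) (Q? : Decidable Q) (R? : Decidable R) →
  R ≐ P ∪ Q → (∀ {a} → P a → ¬ Q a) → count m R R? ≡ count m P P? + count m Q Q?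
count-∪ {m} P? Q? R? R≐P∪Q disjoint =
  trans (count-cong R? (P? ∪? Q?) R≐P∪Q) (length-filter-∪ P? Q? disjoint (allFin m))

module _ {m : ℕ} (f : Fin m → ℕ) where

  below : ℕ → ℕ
  below x = count m (λ a → f a < x) (λ a → f a <? x)

  hits : ℕ → ℕ
  hits x = count m (λ a → f a ≡ x) (λ a → f a ℕ.≟ x)

  below-suc : ∀ x → below (suc x) ≡ below x + hits x
  below-suc x = count-∪ (λ a → f a <? x) (λ a → f a ℕ.≟ x) (λ a → f a <? suc x)
    ((λ lt → m≤n⇒m<n∨m≡n (s≤s⁻¹ lt)) , λ { (inj₁ lt) → m<n⇒m<1+n lt ; (inj₂ refl) → ≤-refl })
    (λ lt eq → <-irrefl eq lt)

  below-1 : (∀ a → 1 ≤ f a) → below 1 ≡ 0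
  below-1 positive = count-none (λ a → f a <? 1) (λ a fa<1 → <⇒≱ fa<1 (positive a))

  hits-miss : ∀ {x} → (∀ a → f a ≢ x) → hits x ≡ 0
  hits-miss {x} miss = count-none (λ a → f a ℕ.≟ x) miss

below-toℕ : {m : ℕ} (t : ℕ) → t ≤ m → below {m} toℕ t ≡ t
below-toℕ {m} zero _ = count-none {m} (λ a → toℕ a <? 0) (λ _ ())
below-toℕ {suc m} (suc t) (s≤s t≤m) = begin
  count (suc m) (λ a → toℕ a < suc t) (λ a → toℕ a <? suc t)
    ≡⟨ count-suc-accept {m} (λ a → toℕ a <? suc t) (s≤s z≤n) ⟩
  suc (count m (λ a → suc (toℕ a) < suc t) (λ a → suc (toℕ a) <? suc t))
    ≡⟨ cong suc (count-cong {m} (λ a → suc (toℕ a) <? suc t) (λ a → toℕ a <? t) (s≤s⁻¹ , s≤s)) ⟩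
  suc (below {m} toℕ t)
    ≡⟨ cong suc (below-toℕ t t≤m) ⟩
  suc t ∎
  where open ≡-Reasoning

hits-toℕ : {m : ℕ} (a : Fin m) → hits {m} toℕ (toℕ a) ≡ 1
hits-toℕ {m} a = +-cancelˡ-≡ (toℕ a) (hits {m} toℕ (toℕ a)) 1 (begin
  toℕ a + hits {m} toℕ (toℕ a)
    ≡⟨ cong (_+ hits {m} toℕ (toℕ a)) (below-toℕ (toℕ a) (<⇒≤ (toℕ<n a))) ⟨
  below {m} toℕ (toℕ a) + hits {m} toℕ (toℕ a)
    ≡⟨ below-suc {m} toℕ (toℕ a) ⟨
  below {m} toℕ (suc (toℕ a))
    ≡⟨ below-toℕ (suc (toℕ a)) (toℕ<n a) ⟩
  suc (toℕ a)
    ≡⟨ +-comm 1 (toℕ a) ⟩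
  toℕ a + 1 ∎)
  where open ≡-Reasoning

module _ {m : ℕ} {f : Fin m → ℕ} (f-inc : StrictlyIncreasing f) where

  inc-mono-≤ : ∀ {a b} → toℕ a ≤ toℕ b → f a ≤ f b
  inc-mono-≤ {a} {b} a≤b with m≤n⇒m<n∨m≡n a≤b
  ... | inj₁ a<b = <⇒≤ (f-inc a b a<b)
  ... | inj₂ a≡b = ≤-reflexive (cong f (toℕ-injective a≡b))

  inc-cancel-< : ∀ {a b} → f a < f b → toℕ a < toℕ b
  inc-cancel-< fa<fb = ≰⇒> (λ b≤a → <⇒≱ fa<fb (inc-mono-≤ b≤a))

  inc-injective : ∀ {a b} → f a ≡ f b → a ≡ b
  inc-injective fa≡fb = toℕ-injective (≤-antisym
    (≮⇒≥ (λ b<a → <-irrefl (sym fa≡fb) (f-inc _ _ b<a)))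
    (≮⇒≥ (λ a<b → <-irrefl fa≡fb (f-inc _ _ a<b))))

  below-at : ∀ a → below f (f a) ≡ toℕ a
  below-at a = trans (count-cong (λ b → f b <? f a) (λ b → toℕ b <? toℕ a) (inc-cancel-< , f-inc _ a))
                     (below-toℕ (toℕ a) (<⇒≤ (toℕ<n a)))

  hits-at : ∀ a → hits f (f a) ≡ 1
  hits-at a = trans
    (count-cong (λ b → f b ℕ.≟ f a) (λ b → toℕ b ℕ.≟ toℕ a) (cong toℕ ∘ inc-injective , cong f ∘ toℕ-injective))
    (hits-toℕ a)

  below-≤ : ∀ {x} j → x < f j → below f x ≤ toℕ j
  below-≤ {x} j x<fj = ≤-trans
    (count-mono (λ b → f b <? x) (λ b → toℕ b <? toℕ j) (λ fb<x → inc-cancel-< (<-trans fb<x x<fj)))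
    (≤-reflexive (below-toℕ (toℕ j) (<⇒≤ (toℕ<n j))))

  below-> : ∀ {x} j → f j < x → toℕ j < below f x
  below-> {x} j fj<x = ≤-trans
    (≤-reflexive (sym (below-toℕ (suc (toℕ j)) (toℕ<n j))))
    (count-mono (λ b → toℕ b <? suc (toℕ j)) (λ b → f b <? x)
                (λ b≤j → ≤-<-trans (inc-mono-≤ (s≤s⁻¹ b≤j)) fj<x))

+-interchange₃ : ∀ a a′ b b′ c c′ → (a + a′) + (b + b′) + (c + c′) ≡ (a + b + c) + (a′ + b′ + c′)
+-interchange₃ = ℕ-Solver.solve-∀

k-V+[1+T]+Z≡k-Y : ∀ k {V} Y Z T → suc (Y + Z + T) ≡ V →
  ((+ k ℤ.- + V) ℤ.+ + suc T) ℤ.+ + Z ≡ + k ℤ.- + Y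
k-V+[1+T]+Z≡k-Y k Y Z T refl
  rewrite ℤ.pos-+ 1 (Y + Z + T) | ℤ.pos-+ (Y + Z) T | ℤ.pos-+ Y Z | ℤ.pos-+ 1 T
  = shape (+ k) (+ Y) (+ Z) (+ T)
  where
  shape : ∀ K Y Z T → ((K ℤ.- (+ 1 ℤ.+ ((Y ℤ.+ Z) ℤ.+ T))) ℤ.+ (+ 1 ℤ.+ T)) ℤ.+ Z ≡ K ℤ.- Y
  shape = ℤ-Solver.solve-∀

module _ {n k r : ℕ} (w : OGData n k r) where
  open OGData w

  hits-partition : ∀ {x} → 1 ≤ x → x ≤ n → hits y x + hits z x + hits v x ≡ 1
  hits-partition {x} 1≤x x≤n with cover x 1≤x x≤n
  ... | inj₁ (a , refl) =
    cong₂ _+_ (cong₂ _+_ (hits-at y-inc a) (hits-miss z (λ b → yz-disj a b ∘ sym)))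
              (hits-miss v (λ b → yv-disj a b ∘ sym))
  ... | inj₂ (inj₁ (a , refl)) =
    cong₂ _+_ (cong₂ _+_ (hits-miss y (λ b → yz-disj b a)) (hits-at z-inc a))
              (hits-miss v (λ b → zv-disj a b ∘ sym))
  ... | inj₂ (inj₂ (a , refl)) =
    cong₂ _+_ (cong₂ _+_ (hits-miss y (λ b → yv-disj b a)) (hits-miss z (λ b → zv-disj b a)))
              (hits-at v-inc a)

  below-partition : ∀ {x} → 1 ≤ x → x ≤ suc n → suc (below y x + below z x + below v x) ≡ x
  below-partition {suc zero} _ _ =
    cong suc (cong₂ _+_ (cong₂ _+_ (below-1 y (proj₁ ∘ y-range)) (below-1 z (proj₁ ∘ z-range)))
                        (below-1 v (proj₁ ∘ v-range)))
  below-partition {suc (suc d)} _ (s≤s 2+d≤1+n) = cong suc (begin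
    below y (2 + d) + below z (2 + d) + below v (2 + d)
      ≡⟨ cong₂ _+_ (cong₂ _+_ (below-suc y (suc d)) (below-suc z (suc d))) (below-suc v (suc d)) ⟩
    (below y (suc d) + hits y (suc d)) + (below z (suc d) + hits z (suc d)) + (below v (suc d) + hits v (suc d))
      ≡⟨ +-interchange₃ (below y (suc d)) (hits y (suc d)) (below z (suc d)) (hits z (suc d))
                        (below v (suc d)) (hits v (suc d)) ⟩
    (below y (suc d) + below z (suc d) + below v (suc d)) + (hits y (suc d) + hits z (suc d) + hits v (suc d))
      ≡⟨ cong₂ _+_ refl (hits-partition (s≤s z≤n) 2+d≤1+n) ⟩
    (below y (suc d) + below z (suc d) + below v (suc d)) + 1
      ≡⟨ +-comm _ 1 ⟩
    suc (below y (suc d) + below z (suc d) + below v (suc d))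
      ≡⟨ below-partition (s≤s z≤n) (m≤n⇒m≤1+n 2+d≤1+n) ⟩
    suc d ∎)
    where open ≡-Reasoning

  v-value : ∀ s → suc (below y (v s) + below z (v s) + toℕ s) ≡ v s
  v-value s = begin
    suc (below y (v s) + below z (v s) + toℕ s)
      ≡⟨ cong (λ t → suc (below y (v s) + below z (v s) + t)) (below-at v-inc s) ⟨
    suc (below y (v s) + below z (v s) + below v (v s))
      ≡⟨ below-partition (proj₁ (v-range s)) (m≤n⇒m≤1+n (proj₂ (v-range s))) ⟩
    v s ∎
    where open ≡-Reasoning

  below-y≤k : ∀ x → below y x ≤ k
  below-y≤k x = ≤-trans (count-≤ (λ a → y a <? x)) (m∸n≤m k r)

  alpha≡k∸below-y : ∀ s → alpha w s ≡ + (k ∸ below y (v s))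
  alpha≡k∸below-y s = begin
    alpha w s                   ≡⟨ k-V+[1+T]+Z≡k-Y k (below y (v s)) (below z (v s)) (toℕ s) (v-value s) ⟩
    + k ℤ.- + below y (v s)     ≡⟨ ℤ.m-n≡m⊖n k (below y (v s)) ⟩
    k ℤ.⊖ below y (v s)         ≡⟨ ℤ.≤-⊖ (below-y≤k (v s)) ⟩
    + (k ∸ below y (v s))       ∎
    where open ≡-Reasoning

  colLen≡count : ∀ i →
    colLen w i ≡ count (n ∸ k) (λ s → i + below y (v s) ≤ k) (λ s → i + below y (v s) ≤? k)
  colLen≡count i = count-cong (λ s → + i ℤ.≤? alpha w s) (λ s → i + below y (v s) ≤? k)
    (i≤α⇒fits , fits⇒i≤α)
    where
    i≤α⇒fits : ∀ {s} → + i ℤ.≤ alpha w s → i + below y (v s) ≤ k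
    i≤α⇒fits {s} i≤α = m≤o∸n⇒m+n≤o i (below-y≤k (v s))
      (ℤ.drop‿+≤+ (subst (+ i ℤ.≤_) (alpha≡k∸below-y s) i≤α))
    fits⇒i≤α : ∀ {s} → i + below y (v s) ≤ k → + i ℤ.≤ alpha w s
    fits⇒i≤α {s} i+b≤k = subst (+ i ℤ.≤_) (sym (alpha≡k∸below-y s)) (ℤ.+≤+ (m+n≤o⇒m≤o∸n i i+b≤k))

  full-column : ∀ {i} → i ≤ r → r ≤ k → colLen w i ≡ n ∸ k
  full-column {i} i≤r r≤k = trans (colLen≡count i) (count-all (λ s → i + below y (v s) ≤? k)
    (λ s → ≤-trans (+-mono-≤ i≤r (count-≤ (λ a → y a <? v s))) (≤-reflexive (m+[n∸m]≡n r≤k))))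

  partial-column : ∀ {i} (j : Fin (k ∸ r)) → toℕ j + i ≡ k →
    colLen w i ≡ count (n ∸ k) (λ s → v s < y j) (λ s → v s <? y j)
  partial-column {i} j j+i≡k = trans (colLen≡count i)
    (count-cong (λ s → i + below y (v s) ≤? k) (λ s → v s <? y j) (fits⇒v<y , v<y⇒fits))
    where
    v<y⇒fits : ∀ {s} → v s < y j → i + below y (v s) ≤ k
    v<y⇒fits {s} vs<yj =
      ≤-trans (+-monoʳ-≤ i (below-≤ y-inc j vs<yj)) (≤-reflexive (trans (+-comm i (toℕ j)) j+i≡k))
    fits⇒v<y : ∀ {s} → i + below y (v s) ≤ k → v s < y j
    fits⇒v<y {s} i+b≤k =
      ≤∧≢⇒< (≮⇒≥ (λ yj<vs → <⇒≱ (below-> y-inc j yj<vs) b≤j)) (λ vs≡yj → yv-disj j s (sym vs≡yj))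
      where
      b≤j : below y (v s) ≤ toℕ j
      b≤j = +-cancelˡ-≤ i _ _ (≤-trans i+b≤k (≤-reflexive (trans (sym j+i≡k) (+-comm (toℕ j) i))))

claim3p10 : (n k r : ℕ) → 1 ≤ k → k < n → r ≤ k → (w : OGData n k r) →
    (∀ (i : ℕ) → 1 ≤ i → i ≤ r → colLen w i ≡ n ∸ k)
    × (∀ (i : ℕ) → r < i → i ≤ k → (j : Fin (k ∸ r)) → toℕ j + i ≡ k →
    colLen w i ≡ count (n ∸ k) (λ l → OGData.v w l < OGData.y w j)
    (λ l → OGData.v w l <? OGData.y w j))
claim3p10 n k r _ _ r≤k w =
  (λ i _ i≤r → full-column w i≤r r≤k) , (λ i _ _ j j+i≡k → partial-column w j j+i≡k)
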